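{- Let $G$ be a connected $\{K_{1,3},Z_{2},N\}$-free graph which contains an induced subgraph $H=H_{4}(\{C_{v_{4}},C_{v_{5}},C_{v_{6}}\})$, where $C_{v_{4}},C_{v_{5}},C_{v_{6}}$ are vertex-disjoint nonempty cliques. Then for each vertex $a\in V(G)\setminus V(H)$ with $N_{G}(a)\cap V(H)\neq\emptyset$, $G[V(H)\cup\{a\}]\in\mathcal{H}_{4}$.
   Context: All graphs are finite and simple; $N_G(a)$ is the neighborhood of $a$, $G[X]$ the induced subgraph. $\mathcal{F}$-free means no member of $\mathcal{F}$ is an induced subgraph. $K_{1,3}$ is the star with three leaves; $Z_2$ is a triangle $abc$ plus a path $ade$ on new vertices $d,e$; $N$ is a triangle with one new pendant vertex attached to each of its three vertices. Expansion: for a graph $H$, expandable set $U\subseteq V(H)$, and pairwise disjoint nonempty cliques $\mathcal{C}=\{C_a\mid a\in U\}$, $H(\mathcal{C})$ replaces each $a\in U$ by the clique $C_a$: a vertex of $C_a$ is adjacent to $u\in V(H)\setminus U$ iff $au\in E(H)$; for distinct $a,b\in U$, $C_a$ is completely joined to $C_b$ if $ab\in E(H)$ and has no edges to it otherwise; other adjacencies as in $H$. $H_4$: vertices $v_1,\dots,v_6$, edges $v_4v_5,v_5v_6,v_6v_4,v_1v_4,v_1v_6,v_2v_4,v_2v_5,v_3v_5,v_3v_6$; $U_4=\{v_4,v_5,v_6\}$. $\mathcal{H}_4$ is the family of graphs isomorphic to some $H_4(\mathcal{C})$ with $\mathcal{C}=\{C_a\mid a\in U_4\}$ pairwise disjoint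 nonempty cliques. -}

module Defs where

open import Data.Nat using (ℕ; zero; suc; _≤_; _≡ᵇ_)
open import Data.Fin using (Fin; toℕ)
open import Data.Bool using (Bool; true; false; _∧_; _∨_; not; if_then_else_)
open import Data.List using (List; []; _∷_; any)
open import Data.Product using (Σ; _×_; _,_; ∃; ∃-syntax)
open import Data.Sum using (_⊎_)
open import Relation.Binary.PropositionalEquality using (_≡_; _≢_)
open import Relation.Nullary using (¬_)
open import Function.Bundles using (_↔_; _⇔_)
open import Function.Definitions using (Injective)

record Graph : Set₁ where
  field
    V   : Set
    adj : V → V → Bool
open Graph public

IsSimple : Graph → Set
IsSimple G = (∀ x y → adj G x y ≡ adj G y x) × (∀ x → adj G x x ≡ false)

Finite : Graph → Set
Finite G = Σ ℕ λ n → V G ↔ Fin n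

data Reach (G : Graph) : V G → V G → Set where
  here : ∀ {x} → Reach G x x
  step : ∀ {x y z} → adj G x y ≡ true → Reach G y z → Reach G x z

Connected : Graph → Set
Connected G = ∀ x y → Reach G x y

record InducedEmb (F G : Graph) : Set where
  field
    map  : V F → V G
    inj  : Injective _≡_ _≡_ map
    pres : ∀ x y → adj G (map x) (map y) ≡ adj F x y
open InducedEmb public

_⊑_ : Graph → Graph → Set
F ⊑ G = InducedEmb F G

memEdge : List (ℕ × ℕ) → ℕ → ℕ → Bool
memEdge [] i j = false
memEdge ((a , b) ∷ es) i j =
  ((a ≡ᵇ i) ∧ (b ≡ᵇ j)) ∨ ((a ≡ᵇ j) ∧ (b ≡ᵇ i)) ∨ memEdge es i j

fromEdges : ℕ → List (ℕ × ℕ) → Graph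
fromEdges m es = record { V = Fin m ; adj = λ x y → memEdge es (toℕ x) (toℕ y) }

K13 : Graph
K13 = fromEdges 4 ((0 , 1) ∷ (0 , 2) ∷ (0 , 3) ∷ [])

-- Z_2: triangle a b c = 0 1 2, path a d e with d = 3, e = 4.
Z2 : Graph
Z2 = fromEdges 5 ((0 , 1) ∷ (1 , 2) ∷ (0 , 2) ∷ (0 , 3) ∷ (3 , 4) ∷ [])

NetG : Graph
NetG = fromEdges 6 ((0 , 1) ∷ (1 , 2) ∷ (0 , 2) ∷ (0 , 3) ∷ (1 , 4) ∷ (2 , 5) ∷ [])

ClawZ2NFree : Graph → Set
ClawZ2NFree G = ¬ (K13 ⊑ G) × ¬ (Z2 ⊑ G) × ¬ (NetG ⊑ G)

-- Expansion H(C) of a graph on Fin m with expandable set U (as a Boolean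
-- predicate) and clique sizes sz : the clique C_a has sz a vertices.
-- Vertices are pairs (a , i) with i : Fin (sz a).
_==F_ : ∀ {m} → Fin m → Fin m → Bool
x ==F y = toℕ x ≡ᵇ toℕ y

Expansion : (m : ℕ) → (Fin m → Fin m → Bool) → (Fin m → Bool) → (Fin m → ℕ) → Graph
Expansion m adjH U sz = record
  { V   = Σ (Fin m) (λ a → Fin (sz a))
  ; adj = λ { (a , i) (b , j) →
        if a ==F b then U a ∧ not (toℕ i ≡ᵇ toℕ j) else adjH a b } }

-- Valid sizes: cliques for a ∈ U nonempty; vertices outside U are kept (one copy).
ValidSizes : (m : ℕ) → (Fin m → Bool) → (Fin m → ℕ) → Set
ValidSizes m U sz = ∀ a → (U a ≡ true → 1 ≤ sz a) × (U a ≡ false → sz a ≡ 1)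

-- H_4 on vertices v1..v6 = 0..5.
H4base : Graph
H4base = fromEdges 6
  ((3 , 4) ∷ (4 , 5) ∷ (5 , 3) ∷ (0 , 3) ∷ (0 , 5) ∷ (1 , 3) ∷ (1 , 4) ∷ (2 , 4) ∷ (2 , 5) ∷ [])

U4 : Fin 6 → Bool
U4 a = 3 Data.Nat.≤ᵇ toℕ a

H4exp : (Fin 6 → ℕ) → Graph
H4exp sz = Expansion 6 (adj H4base) U4 sz

-- The induced subgraph of G on a vertex set X (given as a predicate) is in
-- 𝓗₄: some H_4(C) is isomorphic to G[X], i.e. embeds as an induced subgraph
-- of G with image exactly X.
InH4Family : (G : Graph) → (V G → Set) → Set
InH4Family G X = Σ (Fin 6 → ℕ) λ sz → ValidSizes 6 U4 sz ×
  Σ (H4exp sz ⊑ G) λ e → ∀ w → (∃[ x ] map e x ≡ w) ⇔ X w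

-- Choosing one vertex in each clique of H gives, together with a, the graph H₄ plus a vertex
-- adjacent to some β ⊆ {v₁,…,v₆}. A finite check shows that either β is empty or the closed
-- neighbourhood of v₄, v₅ or v₆, or this 7-vertex graph contains an induced claw or Z₂. Any two
-- of the four admissible sets differ in at least two vertices, so re-choosing the vertex of a
-- single clique cannot change the type of β. Hence a is adjacent to every vertex of the cliques
-- in N[v_X] and to no other vertex of H: it is a true twin of C_X, and adding it to C_X gives
-- again an expansion of H₄.
module Submission where

open import Defs
open import Data.Nat using (ℕ; suc; _≤_; _≡ᵇ_; s≤s; z≤n)
open import Data.Fin using (Fin; zero; suc; toℕ; fromℕ<)
open import Data.Fin.Properties using (_≟_; all?)
open import Data.Bool using (Bool; true; false; _∧_; not; if_then_else_)
open import Data.Bool.Properties using (∧-zeroʳ) renaming (_≟_ to _≟ᵇ_)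
open import Data.Maybe using (Maybe; just; nothing)
open import Data.Maybe.Properties using (just-injective) renaming (≡-dec to ≡-decᴹ)
open import Data.Vec using (Vec; []; _∷_; lookup)
open import Data.Product using (Σ; Σ-syntax; _×_; _,_; ∃; ∃-syntax; proj₁; proj₂)
open import Data.Product.Properties using (,-injectiveˡ; ,-injectiveʳ-UIP)
open import Axiom.UniquenessOfIdentityProofs.WithK using (uip)
open import Data.Sum using (_⊎_; inj₁; inj₂)
import Data.Sum as Sum
open import Function using (_∘_; id)
open import Function.Bundles using (_⇔_; mk⇔)
open import Function.Properties.Equivalence using () renaming (trans to ⇔-trans)
open import Relation.Binary.Definitions using (DecidableEquality)
open import Relation.Binary.PropositionalEquality
  using (_≡_; _≢_; refl; sym; trans; cong; subst; _≗_; ≢-sym; module ≡-Reasoning)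
open import Relation.Nullary using (¬_; Dec; yes; no; does; contradiction)
open import Relation.Nullary.Decidable using (True; toWitness; _⊎-dec_; ¬?; dec-true; dec-false)

infixr 9 _⊚_

_⊚_ : ∀ {F G H} → G ⊑ H → F ⊑ G → F ⊑ H
g ⊚ f = record
  { map  = map g ∘ map f
  ; inj  = inj f ∘ inj g
  ; pres = λ x y → trans (pres g (map f x) (map f y)) (pres f x y) }

FinGraph : (m : ℕ) → (Fin m → Fin m → Bool) → Graph
FinGraph m adjF = record { V = Fin m ; adj = adjF }

module _ {A : Set} (_≟A_ : DecidableEquality A) where

  injective? : ∀ {m} (g : Fin m → A) → Dec (∀ u v → u ≡ v ⊎ g u ≢ g v)
  injective? g = all? λ u → all? λ v → (u ≟ v) ⊎-dec ¬? (g u ≟A g v)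

inducedBy? : ∀ {m} (adjF : Fin m → Fin m → Bool) (H : Graph) (g : Fin m → V H) →
  Dec (∀ u v → adj H (g u) (g v) ≡ adjF u v)
inducedBy? adjF H g = all? λ u → all? λ v → adj H (g u) (g v) ≟ᵇ adjF u v

⊑-by-computation : ∀ {m adjF} (H : Graph) (_≟H_ : DecidableEquality (V H)) (g : Fin m → V H) →
  True (injective? _≟H_ g) → True (inducedBy? adjF H g) → FinGraph m adjF ⊑ H
⊑-by-computation H _≟H_ g injective induced = record
  { map  = g
  ; inj  = λ {u} {v} gu≡gv → separate (toWitness injective u v) gu≡gv
  ; pres = toWitness induced }
  where
  separate : ∀ {u v} → u ≡ v ⊎ g u ≢ g v → g u ≡ g v → u ≡ v
  separate (inj₁ u≡v)  _      = u≡v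
  separate (inj₂ gu≢gv) gu≡gv = contradiction gu≡gv gu≢gv

==F-does : ∀ {m} (x y : Fin m) → (x ==F y) ≡ does (x ≟ y)
==F-does zero    zero    = refl
==F-does zero    (suc y) = refl
==F-does (suc x) zero    = refl
==F-does (suc x) (suc y) = ==F-does x y

==F-refl : ∀ {m} (x : Fin m) → (x ==F x) ≡ true
==F-refl x = trans (==F-does x x) (dec-true (x ≟ x) refl)

==F-≢ : ∀ {m} {x y : Fin m} → x ≢ y → (x ==F y) ≡ false
==F-≢ {x = x} {y} x≢y = trans (==F-does x y) (dec-false (x ≟ y) x≢y)

extensionAdj : (H : Graph) → (V H → Bool) → Maybe (V H) → Maybe (V H) → Bool
extensionAdj H β nothing  nothing  = false
extensionAdj H β nothing  (just y) = β y
extensionAdj H β (just x) nothing  = β x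
extensionAdj H β (just x) (just y) = adj H x y

Extension : (H : Graph) → (V H → Bool) → Graph
Extension H β = record { V = Maybe (V H) ; adj = extensionAdj H β }

Extension-cong-⊑ : ∀ {H β γ} → β ≗ γ → Extension H β ⊑ Extension H γ
Extension-cong-⊑ {H} {β} {γ} β≗γ = record { map = id ; inj = id ; pres = same }
  where
  same : ∀ x y → extensionAdj H γ x y ≡ extensionAdj H β x y
  same nothing  nothing  = refl
  same nothing  (just y) = sym (β≗γ y)
  same (just x) nothing  = sym (β≗γ x)
  same (just x) (just y) = refl

module _ {G H : Graph} (simple : IsSimple G) (e : H ⊑ G) {a : V G} (a∉ : ∀ x → map e x ≢ a) where

  extend : Maybe (V H) → V G
  extend nothing  = a
  extend (just x) = map e x

  extend-⊑ : Extension H (λ x → adj G a (map e x)) ⊑ G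
  extend-⊑ = record { map = extend ; inj = injective ; pres = induced }
    where
    injective : ∀ {x y} → extend x ≡ extend y → x ≡ y
    injective {nothing} {nothing} _  = refl
    injective {nothing} {just y}  eq = contradiction (sym eq) (a∉ y)
    injective {just x}  {nothing} eq = contradiction eq (a∉ x)
    injective {just x}  {just y}  eq = cong just (inj e eq)

    induced : ∀ x y → adj G (extend x) (extend y) ≡ extensionAdj H _ x y
    induced nothing  nothing  = proj₂ simple a
    induced nothing  (just y) = refl
    induced (just x) nothing  = proj₁ simple (map e x) a
    induced (just x) (just y) = pres e x y

  extend-image : ∀ w → (∃[ y ] extend y ≡ w) ⇔ ((∃[ x ] map e x ≡ w) ⊎ w ≡ a)
  extend-image w = mk⇔ to from
    where
    to : ∃[ y ] extend y ≡ w → (∃[ x ] map e x ≡ w) ⊎ w ≡ a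
    to (nothing , a≡w) = inj₂ (sym a≡w)
    to (just x  , ex≡w) = inj₁ (x , ex≡w)

    from : (∃[ x ] map e x ≡ w) ⊎ w ≡ a → ∃[ y ] extend y ≡ w
    from (inj₁ (x , ex≡w)) = just x , ex≡w
    from (inj₂ w≡a)        = nothing , sym w≡a

image-∘-surjective : ∀ {A B C : Set} {f : A → B} (g : B → C) → (∀ y → ∃[ x ] f x ≡ y) →
  ∀ w → (∃[ x ] g (f x) ≡ w) ⇔ (∃[ y ] g y ≡ w)
image-∘-surjective {f = f} g surjective w = mk⇔ (λ (x , gfx≡w) → f x , gfx≡w) from
  where
  from : ∃[ y ] g y ≡ w → ∃[ x ] g (f x) ≡ w
  from (y , gy≡w) with surjective y
  ... | x , refl = x , gy≡w

closedNbhd : ∀ {m} → (Fin m → Fin m → Bool) → Fin m → Fin m → Bool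
closedNbhd adjH X c = if X ==F c then true else adjH X c

someTransversal : ∀ {m U sz} → ValidSizes m U sz → (b : Fin m) → Fin (sz b)
someTransversal {U = U} {sz} valid b = fromℕ< (nonempty (U b) refl)
  where
  nonempty : ∀ u → U b ≡ u → 1 ≤ sz b
  nonempty true  Ub = proj₁ (valid b) Ub
  nonempty false Ub = subst (1 ≤_) (sym (proj₂ (valid b) Ub)) (s≤s z≤n)

transversal-⊑ : ∀ {m adjH U sz} → (∀ b → adjH b b ≡ false) → (k : (b : Fin m) → Fin (sz b)) →
  FinGraph m adjH ⊑ Expansion m adjH U sz
transversal-⊑ {m} {adjH} {U} irreflexive k = record
  { map  = λ b → b , k b
  ; inj  = ,-injectiveˡ
  ; pres = induced }
  where
  induced : ∀ b c → (if b ==F c then U b ∧ not (toℕ (k b) ≡ᵇ toℕ (k c)) else adjH b c) ≡ adjH b c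
  induced b c with b ≟ c
  ... | yes refl rewrite ==F-refl b | ==F-refl (k b) = trans (∧-zeroʳ (U b)) (sym (irreflexive b))
  ... | no b≢c   rewrite ==F-≢ b≢c = refl

grownSize : ∀ {m} (X : Fin m) → (Fin m → ℕ) → (b : Fin m) → Dec (b ≡ X) → ℕ
grownSize X sz b (yes _) = suc (sz b)
grownSize X sz b (no _)  = sz b

grow : ∀ {m} → Fin m → (Fin m → ℕ) → Fin m → ℕ
grow X sz b = grownSize X sz b (b ≟ X)

grow-valid : ∀ {m U sz} {X : Fin m} → U X ≡ true → ValidSizes m U sz → ValidSizes m U (grow X sz)
grow-valid {U = U} {sz} {X} UX valid b = validAt (b ≟ X)
  where
  validAt : (d : Dec (b ≡ X)) → (U b ≡ true → 1 ≤ grownSize X sz b d) × (U b ≡ false → grownSize X sz b d ≡ 1)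
  validAt (yes refl) = (λ _ → s≤s z≤n) , λ UX≡false → contradiction (trans (sym UX) UX≡false) λ ()
  validAt (no _)     = valid b

module _ {m} {adjH : Fin m → Fin m → Bool} (adjH-sym : ∀ i j → adjH i j ≡ adjH j i)
         {U : Fin m → Bool} {sz : Fin m → ℕ} {X : Fin m} (UX : U X ≡ true) where

  twinNbhd : V (Expansion m adjH U sz) → Bool
  twinNbhd (c , _) = closedNbhd adjH X c

  -- Vertex 0 of the grown clique at X is the new twin; its other vertices are the old ones shifted by one.
  shrinkAt : (b : Fin m) (d : Dec (b ≡ X)) → Fin (grownSize X sz b d) → Maybe (V (Expansion m adjH U sz))
  shrinkAt b (yes _) zero    = nothing
  shrinkAt b (yes _) (suc i) = just (b , i)
  shrinkAt b (no _)  i       = just (b , i)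

  shrink : V (Expansion m adjH U (grow X sz)) → Maybe (V (Expansion m adjH U sz))
  shrink (b , i) = shrinkAt b (b ≟ X) i

  shrinkAt-clique : ∀ b d i c d′ j → shrinkAt b d i ≡ shrinkAt c d′ j → b ≡ c
  shrinkAt-clique b (yes refl) zero    c (yes refl) zero    _  = refl
  shrinkAt-clique b (yes _)    (suc i) c (yes _)    (suc j) eq = cong proj₁ (just-injective eq)
  shrinkAt-clique b (yes _)    (suc i) c (no _)     j       eq = cong proj₁ (just-injective eq)
  shrinkAt-clique b (no _)     i       c (yes _)    (suc j) eq = cong proj₁ (just-injective eq)
  shrinkAt-clique b (no _)     i       c (no _)     j       eq = cong proj₁ (just-injective eq)
  shrinkAt-clique b (yes _)    zero    c (yes _)    (suc j) ()
  shrinkAt-clique b (yes _)    zero    c (no _)     j       ()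
  shrinkAt-clique b (yes _)    (suc i) c (yes _)    zero    ()
  shrinkAt-clique b (no _)     i       c (yes _)    zero    ()

  shrinkAt-injective : ∀ b d (i j : Fin (grownSize X sz b d)) → shrinkAt b d i ≡ shrinkAt b d j → i ≡ j
  shrinkAt-injective b (yes _) zero    zero    _  = refl
  shrinkAt-injective b (yes _) (suc i) (suc j) eq = cong suc (,-injectiveʳ-UIP uip (just-injective eq))
  shrinkAt-injective b (no _)  i       j       eq = ,-injectiveʳ-UIP uip (just-injective eq)
  shrinkAt-injective b (yes _) zero    (suc j) ()
  shrinkAt-injective b (yes _) (suc i) zero    ()

  shrink-injective : ∀ {x y} → shrink x ≡ shrink y → x ≡ y
  shrink-injective {b , i} {c , j} eq with shrinkAt-clique b (b ≟ X) i c (c ≟ X) j eq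
  ... | refl = cong (b ,_) (shrinkAt-injective b (b ≟ X) i j eq)

  shrinkAt-induced : ∀ b d i c d′ j →
    extensionAdj (Expansion m adjH U sz) twinNbhd (shrinkAt b d i) (shrinkAt c d′ j)
      ≡ (if b ==F c then U b ∧ not (toℕ i ≡ᵇ toℕ j) else adjH b c)
  shrinkAt-induced b (yes refl) zero c (yes refl) zero rewrite ==F-refl X = sym (∧-zeroʳ (U X))
  shrinkAt-induced b (yes refl) zero c (yes refl) (suc j) rewrite ==F-refl X | UX = refl
  shrinkAt-induced b (yes refl) (suc i) c (yes refl) zero rewrite ==F-refl X | UX = refl
  shrinkAt-induced b (yes refl) (suc i) c (yes refl) (suc j) = refl
  shrinkAt-induced b (yes refl) zero c (no c≢X) j rewrite ==F-≢ (≢-sym c≢X) = refl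
  shrinkAt-induced b (yes refl) (suc i) c (no c≢X) j rewrite ==F-≢ (≢-sym c≢X) = refl
  shrinkAt-induced b (no b≢X) i c (yes refl) zero rewrite ==F-≢ b≢X | ==F-≢ (≢-sym b≢X) = adjH-sym X b
  shrinkAt-induced b (no b≢X) i c (yes refl) (suc j) rewrite ==F-≢ b≢X = refl
  shrinkAt-induced b (no _) i c (no _) j = refl

  grow-⊑ : Expansion m adjH U (grow X sz) ⊑ Extension (Expansion m adjH U sz) twinNbhd
  grow-⊑ = record
    { map  = shrink
    ; inj  = shrink-injective
    ; pres = λ { (b , i) (c , j) → shrinkAt-induced b (b ≟ X) i c (c ≟ X) j } }

  shrink-surjective : ∀ y → ∃[ x ] shrink x ≡ y
  shrink-surjective nothing        = (X , twinAt (X ≟ X)) , twinAt-shrinks (X ≟ X)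
    where
    twinAt : (d : Dec (X ≡ X)) → Fin (grownSize X sz X d)
    twinAt (yes _)   = zero
    twinAt (no X≢X)  = contradiction refl X≢X

    twinAt-shrinks : ∀ d → shrinkAt X d (twinAt d) ≡ nothing
    twinAt-shrinks (yes _)  = refl
    twinAt-shrinks (no X≢X) = contradiction refl X≢X
  shrink-surjective (just (b , i)) = (b , oldAt (b ≟ X)) , oldAt-shrinks (b ≟ X)
    where
    oldAt : (d : Dec (b ≡ X)) → Fin (grownSize X sz b d)
    oldAt (yes _) = suc i
    oldAt (no _)  = i

    oldAt-shrinks : ∀ d → shrinkAt b d (oldAt d) ≡ just (b , i)
    oldAt-shrinks (yes _) = refl
    oldAt-shrinks (no _)  = refl

module _ {G : Graph} (simple : IsSimple G) {m} {adjH : Fin m → Fin m → Bool}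
         (adjH-sym : ∀ i j → adjH i j ≡ adjH j i) {U : Fin m → Bool} {sz : Fin m → ℕ}
         (e : Expansion m adjH U sz ⊑ G) {a : V G} (a∉ : ∀ x → map e x ≢ a)
         {X : Fin m} (UX : U X ≡ true) (twin : ∀ c l → adj G a (map e (c , l)) ≡ closedNbhd adjH X c) where

  addTwin-⊑ : Expansion m adjH U (grow X sz) ⊑ G
  addTwin-⊑ = extend-⊑ simple e a∉ ⊚ Extension-cong-⊑ (λ (c , l) → sym (twin c l)) ⊚ grow-⊑ adjH-sym UX

  addTwin-image : ∀ w → (∃[ x ] map addTwin-⊑ x ≡ w) ⇔ ((∃[ x ] map e x ≡ w) ⊎ w ≡ a)
  addTwin-image w = ⇔-trans (image-∘-surjective (extend simple e a∉) (shrink-surjective adjH-sym UX) w)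
                            (extend-image simple e a∉ w)

update : ∀ {n} {A : Fin n → Set} → ((b : Fin n) → A b) → (c : Fin n) → A c → (b : Fin n) → A b
update k c x b with c ≟ b
... | yes refl = x
... | no _     = k b

update-same : ∀ {n} {A : Fin n → Set} (k : (b : Fin n) → A b) c x → update k c x c ≡ x
update-same k c x with c ≟ c
... | yes refl = refl
... | no c≢c   = contradiction refl c≢c

update-other : ∀ {n} {A : Fin n → Set} (k : (b : Fin n) → A b) c x b → b ≢ c → update k c x b ≡ k b
update-other k c x b b≢c with c ≟ b
... | yes refl = contradiction refl b≢c
... | no _     = refl

DifferTwice : ∀ {n} {B : Set} → (Fin n → B) → (Fin n → B) → Set
DifferTwice {n} β γ = Σ[ j₁ ∈ Fin n ] Σ[ j₂ ∈ Fin n ] j₁ ≢ j₂ × β j₁ ≢ γ j₁ × β j₂ ≢ γ j₂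

differTwice-rigid : ∀ {n} {B : Set} {β γ : Fin n → B} → DifferTwice β γ →
  ∀ c → ¬ (∀ j → j ≢ c → β j ≡ γ j)
differTwice-rigid (j₁ , j₂ , j₁≢j₂ , β≢γ₁ , β≢γ₂) c agree with j₁ ≟ c
... | yes refl = β≢γ₂ (agree j₂ (≢-sym j₁≢j₂))
... | no j₁≢c  = β≢γ₁ (agree j₁ j₁≢c)

pattern v₁ = zero
pattern v₂ = suc zero
pattern v₃ = suc (suc zero)
pattern v₄ = suc (suc (suc zero))
pattern v₅ = suc (suc (suc (suc zero)))
pattern v₆ = suc (suc (suc (suc (suc zero))))
pattern new = nothing

H4-sym : ∀ i j → adj H4base i j ≡ adj H4base j i
H4-sym = toWitness {a? = all? λ i → all? λ j → adj H4base i j ≟ᵇ adj H4base j i} _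

H4-irreflexive : ∀ i → adj H4base i i ≡ false
H4-irreflexive = toWitness {a? = all? λ i → adj H4base i i ≟ᵇ false} _

data Attachment : Set where
  isolated twin₄ twin₅ twin₆ : Attachment

neighbourhood : Attachment → Fin 6 → Bool
neighbourhood isolated _ = false
neighbourhood twin₄      = closedNbhd (adj H4base) v₄
neighbourhood twin₅      = closedNbhd (adj H4base) v₅
neighbourhood twin₆      = closedNbhd (adj H4base) v₆

Admissible : (Fin 6 → Bool) → Set
Admissible β = Σ[ P ∈ Attachment ] β ≗ neighbourhood P

neighbourhoods-differTwice : ∀ P Q → P ≡ Q ⊎ DifferTwice (neighbourhood P) (neighbourhood Q)
neighbourhoods-differTwice isolated isolated = inj₁ refl
neighbourhoods-differTwice twin₄    twin₄    = inj₁ refl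
neighbourhoods-differTwice twin₅    twin₅    = inj₁ refl
neighbourhoods-differTwice twin₆    twin₆    = inj₁ refl
neighbourhoods-differTwice isolated twin₄    = inj₂ (v₄ , v₅ , (λ ()) , (λ ()) , (λ ()))
neighbourhoods-differTwice isolated twin₅    = inj₂ (v₄ , v₅ , (λ ()) , (λ ()) , (λ ()))
neighbourhoods-differTwice isolated twin₆    = inj₂ (v₄ , v₅ , (λ ()) , (λ ()) , (λ ()))
neighbourhoods-differTwice twin₄    isolated = inj₂ (v₄ , v₅ , (λ ()) , (λ ()) , (λ ()))
neighbourhoods-differTwice twin₅    isolated = inj₂ (v₄ , v₅ , (λ ()) , (λ ()) , (λ ()))
neighbourhoods-differTwice twin₆    isolated = inj₂ (v₄ , v₅ , (λ ()) , (λ ()) , (λ ()))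
neighbourhoods-differTwice twin₄    twin₅    = inj₂ (v₁ , v₃ , (λ ()) , (λ ()) , (λ ()))
neighbourhoods-differTwice twin₅    twin₄    = inj₂ (v₁ , v₃ , (λ ()) , (λ ()) , (λ ()))
neighbourhoods-differTwice twin₄    twin₆    = inj₂ (v₂ , v₃ , (λ ()) , (λ ()) , (λ ()))
neighbourhoods-differTwice twin₆    twin₄    = inj₂ (v₂ , v₃ , (λ ()) , (λ ()) , (λ ()))
neighbourhoods-differTwice twin₅    twin₆    = inj₂ (v₁ , v₂ , (λ ()) , (λ ()) , (λ ()))
neighbourhoods-differTwice twin₆    twin₅    = inj₂ (v₁ , v₂ , (λ ()) , (λ ()) , (λ ()))

attachment-rigid : ∀ P Q c → (∀ j → j ≢ c → neighbourhood P j ≡ neighbourhood Q j) → P ≡ Q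
attachment-rigid P Q c agree with neighbourhoods-differTwice P Q
... | inj₁ P≡Q       = P≡Q
... | inj₂ different = contradiction agree (differTwice-rigid different c)

Forbidden : Graph → Set
Forbidden F = K13 ⊑ F ⊎ Z2 ⊑ F

Forbidden-⊑ : ∀ {F G} → F ⊑ G → Forbidden F → Forbidden G
Forbidden-⊑ f = Sum.map (f ⊚_) (f ⊚_)

Outcome : (Fin 6 → Bool) → Set
Outcome β = Admissible β ⊎ Forbidden (Extension H4base β)

_≟ᴹ_ : DecidableEquality (Maybe (Fin 6))
_≟ᴹ_ = ≡-decᴹ _≟_

admissible : ∀ {β} P → {True (all? λ j → β j ≟ᵇ neighbourhood P j)} → Outcome β
admissible P {agree} = inj₁ (P , toWitness agree)

claw : ∀ {β} (g : Vec (Maybe (Fin 6)) 4) → {True (injective? _≟ᴹ_ (lookup g))} →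
  {True (inducedBy? (adj K13) (Extension H4base β) (lookup g))} → Outcome β
claw g {injective} {induced} = inj₂ (inj₁ (⊑-by-computation _ _≟ᴹ_ (lookup g) injective induced))

z₂ : ∀ {β} (g : Vec (Maybe (Fin 6)) 5) → {True (injective? _≟ᴹ_ (lookup g))} →
  {True (inducedBy? (adj Z2) (Extension H4base β) (lookup g))} → Outcome β
z₂ g {injective} {induced} = inj₂ (inj₂ (⊑-by-computation _ _≟ᴹ_ (lookup g) injective induced))

-- The witnesses list the images of the vertices of K13 (centre first) and of Z2 (triangle a b c, then d, e).
classify : ∀ b₁ b₂ b₃ b₄ b₅ b₆ → Outcome (lookup (b₁ ∷ b₂ ∷ b₃ ∷ b₄ ∷ b₅ ∷ b₆ ∷ []))
classify false false false false false false = admissible isolated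
classify false false false false false true = claw (just v₆ ∷ just v₁ ∷ just v₃ ∷ new ∷ [])
classify false false false false true false = claw (just v₅ ∷ just v₂ ∷ just v₃ ∷ new ∷ [])
classify false false false false true true = claw (just v₅ ∷ just v₂ ∷ just v₃ ∷ new ∷ [])
classify false false false true false false = claw (just v₄ ∷ just v₁ ∷ just v₂ ∷ new ∷ [])
classify false false false true false true = claw (just v₄ ∷ just v₁ ∷ just v₂ ∷ new ∷ [])
classify false false false true true false = claw (just v₄ ∷ just v₁ ∷ just v₂ ∷ new ∷ [])
classify false false false true true true = claw (just v₄ ∷ just v₁ ∷ just v₂ ∷ new ∷ [])
classify false false true false false false = z₂ (just v₅ ∷ just v₂ ∷ just v₄ ∷ just v₃ ∷ new ∷ [])
classify false false true false false true = claw (just v₆ ∷ just v₁ ∷ just v₅ ∷ new ∷ [])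
classify false false true false true false = claw (just v₅ ∷ just v₂ ∷ just v₆ ∷ new ∷ [])
classify false false true false true true = z₂ (just v₅ ∷ just v₃ ∷ new ∷ just v₄ ∷ just v₁ ∷ [])
classify false false true true false false = claw (just v₄ ∷ just v₁ ∷ just v₂ ∷ new ∷ [])
classify false false true true false true = claw (just v₄ ∷ just v₁ ∷ just v₂ ∷ new ∷ [])
classify false false true true true false = claw (just v₄ ∷ just v₁ ∷ just v₂ ∷ new ∷ [])
classify false false true true true true = claw (just v₄ ∷ just v₁ ∷ just v₂ ∷ new ∷ [])
classify false true false false false false = z₂ (just v₄ ∷ just v₁ ∷ just v₆ ∷ just v₂ ∷ new ∷ [])
classify false true false false false true = claw (just v₆ ∷ just v₁ ∷ just v₃ ∷ new ∷ [])
classify false true false false true false = claw (just v₅ ∷ just v₃ ∷ just v₄ ∷ new ∷ [])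
classify false true false false true true = claw (just v₅ ∷ just v₃ ∷ just v₄ ∷ new ∷ [])
classify false true false true false false = claw (just v₄ ∷ just v₁ ∷ just v₅ ∷ new ∷ [])
classify false true false true false true = claw (just v₄ ∷ just v₁ ∷ just v₅ ∷ new ∷ [])
classify false true false true true false = z₂ (just v₄ ∷ just v₂ ∷ new ∷ just v₆ ∷ just v₃ ∷ [])
classify false true false true true true = claw (just v₆ ∷ just v₁ ∷ just v₃ ∷ new ∷ [])
classify false true true false false false = z₂ (just v₄ ∷ just v₁ ∷ just v₆ ∷ just v₂ ∷ new ∷ [])
classify false true true false false true = claw (just v₆ ∷ just v₁ ∷ just v₅ ∷ new ∷ [])
classify false true true false true false = z₂ (just v₄ ∷ just v₁ ∷ just v₆ ∷ just v₂ ∷ new ∷ [])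
classify false true true false true true = z₂ (just v₅ ∷ just v₃ ∷ new ∷ just v₄ ∷ just v₁ ∷ [])
classify false true true true false false = claw (just v₄ ∷ just v₁ ∷ just v₅ ∷ new ∷ [])
classify false true true true false true = claw (just v₄ ∷ just v₁ ∷ just v₅ ∷ new ∷ [])
classify false true true true true false = z₂ (just v₅ ∷ just v₂ ∷ new ∷ just v₆ ∷ just v₁ ∷ [])
classify false true true true true true = admissible twin₅
classify true false false false false false = z₂ (just v₄ ∷ just v₂ ∷ just v₅ ∷ just v₁ ∷ new ∷ [])
classify true false false false false true = claw (just v₆ ∷ just v₃ ∷ just v₄ ∷ new ∷ [])
classify true false false false true false = claw (just v₅ ∷ just v₂ ∷ just v₃ ∷ new ∷ [])
classify true false false false true true = claw (just v₅ ∷ just v₂ ∷ just v₃ ∷ new ∷ [])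
classify true false false true false false = claw (just v₄ ∷ just v₂ ∷ just v₆ ∷ new ∷ [])
classify true false false true false true = z₂ (just v₄ ∷ just v₁ ∷ new ∷ just v₅ ∷ just v₃ ∷ [])
classify true false false true true false = claw (just v₄ ∷ just v₂ ∷ just v₆ ∷ new ∷ [])
classify true false false true true true = claw (just v₅ ∷ just v₂ ∷ just v₃ ∷ new ∷ [])
classify true false true false false false = z₂ (just v₄ ∷ just v₂ ∷ just v₅ ∷ just v₁ ∷ new ∷ [])
classify true false true false false true = z₂ (just v₄ ∷ just v₂ ∷ just v₅ ∷ just v₁ ∷ new ∷ [])
classify true false true false true false = claw (just v₅ ∷ just v₂ ∷ just v₆ ∷ new ∷ [])
classify true false true false true true = z₂ (just v₆ ∷ just v₃ ∷ new ∷ just v₄ ∷ just v₂ ∷ [])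
classify true false true true false false = claw (just v₄ ∷ just v₂ ∷ just v₆ ∷ new ∷ [])
classify true false true true false true = z₂ (just v₆ ∷ just v₁ ∷ new ∷ just v₅ ∷ just v₂ ∷ [])
classify true false true true true false = claw (just v₄ ∷ just v₂ ∷ just v₆ ∷ new ∷ [])
classify true false true true true true = admissible twin₆
classify true true false false false false = z₂ (just v₅ ∷ just v₃ ∷ just v₆ ∷ just v₂ ∷ new ∷ [])
classify true true false false false true = claw (just v₆ ∷ just v₃ ∷ just v₄ ∷ new ∷ [])
classify true true false false true false = claw (just v₅ ∷ just v₃ ∷ just v₄ ∷ new ∷ [])
classify true true false false true true = claw (just v₅ ∷ just v₃ ∷ just v₄ ∷ new ∷ [])
classify true true false true false false = z₂ (just v₄ ∷ just v₁ ∷ new ∷ just v₅ ∷ just v₃ ∷ [])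
classify true true false true false true = z₂ (just v₄ ∷ just v₁ ∷ new ∷ just v₅ ∷ just v₃ ∷ [])
classify true true false true true false = z₂ (just v₄ ∷ just v₂ ∷ new ∷ just v₆ ∷ just v₃ ∷ [])
classify true true false true true true = admissible twin₄
classify true true true false false false = claw (new ∷ just v₁ ∷ just v₂ ∷ just v₃ ∷ [])
classify true true true false false true = claw (new ∷ just v₁ ∷ just v₂ ∷ just v₃ ∷ [])
classify true true true false true false = claw (new ∷ just v₁ ∷ just v₂ ∷ just v₃ ∷ [])
classify true true true false true true = claw (new ∷ just v₁ ∷ just v₂ ∷ just v₃ ∷ [])
classify true true true true false false = claw (new ∷ just v₁ ∷ just v₂ ∷ just v₃ ∷ [])
classify true true true true false true = claw (new ∷ just v₁ ∷ just v₂ ∷ just v₃ ∷ [])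
classify true true true true true false = claw (new ∷ just v₁ ∷ just v₂ ∷ just v₃ ∷ [])
classify true true true true true true = claw (new ∷ just v₁ ∷ just v₂ ∷ just v₃ ∷ [])

outcome : ∀ β → Outcome β
outcome β = Sum.map (λ (P , agree) → P , λ j → trans (tabulated j) (agree j))
                         (Forbidden-⊑ (Extension-cong-⊑ (sym ∘ tabulated)))
                         (classify (β v₁) (β v₂) (β v₃) (β v₄) (β v₅) (β v₆))
  where
  tabulated : β ≗ lookup (β v₁ ∷ β v₂ ∷ β v₃ ∷ β v₄ ∷ β v₅ ∷ β v₆ ∷ [])
  tabulated v₁ = refl
  tabulated v₂ = refl
  tabulated v₃ = refl
  tabulated v₄ = refl
  tabulated v₅ = refl
  tabulated v₆ = refl

admissible-of-free : ∀ {G β} → ClawZ2NFree G → Extension H4base β ⊑ G → Admissible β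
admissible-of-free {β = β} (clawFree , z₂Free , _) e with outcome β
... | inj₁ admissibleβ = admissibleβ
... | inj₂ (inj₁ clawβ) = contradiction (e ⊚ clawβ) clawFree
... | inj₂ (inj₂ z₂β)   = contradiction (e ⊚ z₂β) z₂Free

module _ {G : Graph} (simple : IsSimple G) (free : ClawZ2NFree G) {sz : Fin 6 → ℕ}
         (e : H4exp sz ⊑ G) {a : V G} (a∉ : ∀ x → map e x ≢ a) where

  open ≡-Reasoning

  Transversal : Set
  Transversal = (b : Fin 6) → Fin (sz b)

  trace : Transversal → Fin 6 → Bool
  trace k b = adj G a (map e (b , k b))

  trace-admissible : ∀ k → Admissible (trace k)
  trace-admissible k =
    admissible-of-free free (extend-⊑ simple (e ⊚ transversal-⊑ H4-irreflexive k) (λ b → a∉ (b , k b)))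

  attachmentOf : Transversal → Attachment
  attachmentOf k = proj₁ (trace-admissible k)

  attachmentOf-update : ∀ k c l → attachmentOf (update k c l) ≡ attachmentOf k
  attachmentOf-update k c l = attachment-rigid _ _ c agree
    where
    agree : ∀ j → j ≢ c → neighbourhood (attachmentOf (update k c l)) j ≡ neighbourhood (attachmentOf k) j
    agree j j≢c = begin
      neighbourhood (attachmentOf (update k c l)) j ≡⟨ proj₂ (trace-admissible (update k c l)) j ⟨
      trace (update k c l) j                        ≡⟨ cong (λ x → adj G a (map e (j , x))) (update-other k c l j j≢c) ⟩
      trace k j                                     ≡⟨ proj₂ (trace-admissible k) j ⟩
      neighbourhood (attachmentOf k) j              ∎

  attachment-uniform : ∀ k c l → adj G a (map e (c , l)) ≡ neighbourhood (attachmentOf k) c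
  attachment-uniform k c l = begin
    adj G a (map e (c , l))                       ≡⟨ cong (λ x → adj G a (map e (c , x))) (update-same k c l) ⟨
    trace (update k c l) c                        ≡⟨ proj₂ (trace-admissible (update k c l)) c ⟩
    neighbourhood (attachmentOf (update k c l)) c ≡⟨ cong (λ P → neighbourhood P c) (attachmentOf-update k c l) ⟩
    neighbourhood (attachmentOf k) c              ∎

  twin-of-attached : ValidSizes 6 U4 sz → ∃[ x ] adj G a (map e x) ≡ true →
    Σ[ X ∈ Fin 6 ] U4 X ≡ true × (∀ c l → adj G a (map e (c , l)) ≡ closedNbhd (adj H4base) X c)
  twin-of-attached valid ((b , l) , a~bl)
    with attachmentOf (someTransversal valid) | attachment-uniform (someTransversal valid)
  ... | isolated | uniform = contradiction (trans (sym a~bl) (uniform b l)) λ ()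
  ... | twin₄    | uniform = v₄ , refl , uniform
  ... | twin₅    | uniform = v₅ , refl , uniform
  ... | twin₆    | uniform = v₆ , refl , uniform

lemma2p5 : (G : Graph) → IsSimple G → Finite G → Connected G → ClawZ2NFree G →
    (sz : Fin 6 → ℕ) → ValidSizes 6 U4 sz → (e : H4exp sz ⊑ G) →
    (a : V G) → (∀ x → map e x ≢ a) → (∃[ x ] adj G a (map e x) ≡ true) →
    InH4Family G (λ w → (∃[ x ] map e x ≡ w) ⊎ w ≡ a)
lemma2p5 G simple _ _ free sz valid e a a∉ attached
  with twin-of-attached simple free e a∉ valid attached
... | X , UX , twin =
  grow X sz , grow-valid UX valid ,
  addTwin-⊑ simple H4-sym e a∉ UX twin , addTwin-image simple H4-sym e a∉ UX twin
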